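{- Let $r,s,t$ be integers with $1\leq r\leq s\leq t$ and $r\geq 5$. Then the graph $\Delta_{r,s,t}$ has no interval coloring, i.e. $\Delta_{r,s,t}\notin \mathfrak{N}$.
   Context: All graphs are finite, without loops or multiple edges. For a graph $G$ and a proper edge-coloring $\alpha$, $S(v,\alpha)$ denotes the set of colors of edges incident to $v$. An interval $t$-coloring of $G$ is a proper edge-coloring of $G$ with colors $1,\ldots,t$ such that every color is used and for every vertex $v$ the set $S(v,\alpha)$ is an interval of integers. $\mathfrak{N}$ denotes the set of graphs having an interval $t$-coloring for some positive integer $t$. For $1\leq r\leq s\leq t$, the graph $\Delta_{r,s,t}$ has vertex set $\{v,x,y,z\}\cup\{a_1,\ldots,a_r,b_1,\ldots,b_s,c_1,\ldots,c_t\}$ and edge set $\{va_i,xa_i,ya_i:1\leq i\leq r\}\cup\{vb_j,xb_j,zb_j:1\leq j\leq s\}\cup\{vc_k,yc_k,zc_k:1\leq k\leq t\}$. It is a connected bipartite graph with maximum degree $r+s+t$. -}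

module Defs where

open import Data.Nat using (ℕ; _≤_)
open import Data.Fin using (Fin)
open import Data.Product using (_×_; _,_; proj₁; proj₂; ∃; Σ)
open import Data.Sum using (_⊎_)
open import Relation.Binary.PropositionalEquality using (_≡_; _≢_)

record Graph : Set₁ where
  field
    V    : Set
    E    : Set
    ends : E → V × V

open Graph public

Incident : (G : Graph) → V G → E G → Set
Incident G u e = (proj₁ (ends G e) ≡ u) ⊎ (proj₂ (ends G e) ≡ u)

record IntervalColoring (G : Graph) (t : ℕ) : Set where
  field
    colour    : E G → ℕ
    inRange   : ∀ e → 1 ≤ colour e × colour e ≤ t
    proper    : ∀ u e e' → Incident G u e → Incident G u e' → e ≢ e'
                → colour e ≢ colour e'
    allUsed   : ∀ c → 1 ≤ c → c ≤ t → ∃ λ e → colour e ≡ c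
    intervals : ∀ u e₁ e₂ c → Incident G u e₁ → Incident G u e₂
                → colour e₁ ≤ c → c ≤ colour e₂
                → ∃ λ e → Incident G u e × colour e ≡ c

Interval𝔑 : Graph → Set
Interval𝔑 G = Σ ℕ λ t → 1 ≤ t × IntervalColoring G t

data ΔV (r s t : ℕ) : Set where
  v x y z : ΔV r s t
  a : Fin r → ΔV r s t
  b : Fin s → ΔV r s t
  c : Fin t → ΔV r s t

data ΔE (r s t : ℕ) : Set where
  va xa ya : Fin r → ΔE r s t
  vb xb zb : Fin s → ΔE r s t
  vc yc zc : Fin t → ΔE r s t

Δends : ∀ {r s t} → ΔE r s t → ΔV r s t × ΔV r s t
Δends (va i) = v , a i
Δends (xa i) = x , a i
Δends (ya i) = y , a i
Δends (vb j) = v , b j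
Δends (xb j) = x , b j
Δends (zb j) = z , b j
Δends (vc k) = v , c k
Δends (yc k) = y , c k
Δends (zc k) = z , c k

Δ : ℕ → ℕ → ℕ → Graph
Δ r s t = record { V = ΔV r s t ; E = ΔE r s t ; ends = Δends }

module Submission where

-- Let α be an interval colouring.  The N = r + s + t edges at v carry
-- distinct colours, so some two of them, e and e′, satisfy
-- colour e + N ≤ colour e′ + 1 (the lower bound `span-at-least`).
-- Conversely, every vertex u of degree at most n sees an interval of at most n
-- colours, so any two edges at u differ in colour by less than n (the upper
-- bound `span-below`).  The leaves a_i, b_j, c_k have degree 3, and any two
-- leaves share a neighbour among the hubs x, y, z, whose degree D is the sum
-- of two of r, s, t, hence D + 5 ≤ N.  Walking from e to e′ along
-- leaf – hub – leaf (a `Bridge`) shows colour e′ < colour e + (D + 4),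
-- contradicting the lower bound.

open import Defs
open import Data.Nat using (ℕ; _≤_)
open import Relation.Nullary using (¬_)

open import Data.Nat using (suc; _+_; _∸_; _<_; _≤?_; s≤s; s≤s⁻¹)
open import Data.Nat.Properties
open import Data.Fin using (Fin; toℕ; fromℕ<; splitAt; join; _↑ˡ_; _↑ʳ_) renaming (zero to fzero; suc to fsuc)
open import Data.Fin.Properties using (toℕ-injective; toℕ<n; toℕ-fromℕ<; injective⇒≤; splitAt-↑ˡ; splitAt-↑ʳ; join-splitAt)
  renaming (_≟_ to _≟ᶠ_)
open import Data.List using (allFin)
open import Data.List.Extrema.Nat using (argmin; argmax; f[argmin]≤f[xs]; f[xs]≤f[argmax])
open import Data.List.Membership.Propositional.Properties using (∈-allFin)
import Data.List.Relation.Unary.All as All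
open import Data.Vec using ([]; _∷_; lookup)
open import Data.Product using (_×_; _,_; proj₁; proj₂; ∃; ∃₂)
open import Data.Sum using (inj₁; inj₂; [_,_])
open import Data.Empty using (⊥-elim)
open import Function using (_∘_)
open import Function.Definitions using (Injective)
open import Relation.Nullary using (yes; no)
open import Relation.Binary.PropositionalEquality using (_≡_; _≢_; refl; sym; trans; cong; subst; module ≡-Reasoning)
open import Data.Nat.Tactic.RingSolver using (solve-∀)

minimum : ∀ {n} (f : Fin (suc n) → ℕ) → ∃ λ i → ∀ k → f i ≤ f k
minimum {n} f = argmin f fzero (allFin (suc n)) ,
  λ k → All.lookup (f[argmin]≤f[xs] {f = f} fzero (allFin (suc n))) (∈-allFin k)

maximum : ∀ {n} (f : Fin (suc n) → ℕ) → ∃ λ j → ∀ k → f k ≤ f j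
maximum {n} f = argmax f fzero (allFin (suc n)) ,
  λ k → All.lookup (f[xs]≤f[argmax] {f = f} fzero (allFin (suc n))) (∈-allFin k)

injective-span : ∀ {n} (f : Fin n → ℕ) → Injective _≡_ _≡_ f → 0 < n
               → ∃₂ λ i j → f i + n ≤ suc (f j)
injective-span {suc n} f f-inj _ with minimum f | maximum f
... | i , lo | j , hi = i , j , (begin
    f i + suc n                 ≤⟨ +-monoʳ-≤ (f i) (injective⇒≤ offset-injective) ⟩
    f i + suc (f j ∸ f i)       ≡⟨ +-suc (f i) (f j ∸ f i) ⟩
    suc (f i + (f j ∸ f i))     ≡⟨ cong suc (m+[n∸m]≡n (lo j)) ⟩
    suc (f j)                   ∎)
  where
  open ≤-Reasoning
  -- every value lies in [f i, f j], so shifting by f i lands in Fin (1 + f j ∸ f i)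
  offset : Fin (suc n) → Fin (suc (f j ∸ f i))
  offset k = fromℕ< (s≤s (∸-monoˡ-≤ (f i) (hi k)))
  offset-injective : Injective _≡_ _≡_ offset
  offset-injective {k} {k′} eq = f-inj (begin-equality
    f k                   ≡⟨ m+[n∸m]≡n (lo k) ⟨
    f i + (f k ∸ f i)     ≡⟨ cong (f i +_) shifted ⟩
    f i + (f k′ ∸ f i)    ≡⟨ m+[n∸m]≡n (lo k′) ⟩
    f k′                  ∎)
    where
    shifted : f k ∸ f i ≡ f k′ ∸ f i
    shifted = trans (sym (toℕ-fromℕ< _)) (trans (cong toℕ eq) (toℕ-fromℕ< _))

<-+-trans : ∀ {m n o} p q → m < n + suc p → n < o + q → m < o + (p + q)
<-+-trans {m} {n} {o} p q m<n+1+p n<o+q = begin-strict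
  m            ≤⟨ s≤s⁻¹ (subst (suc m ≤_) (+-suc n p) m<n+1+p) ⟩
  n + p        <⟨ +-monoˡ-< p n<o+q ⟩
  o + q + p    ≡⟨ +-assoc o q p ⟩
  o + (q + p)  ≡⟨ cong (o +_) (+-comm q p) ⟩
  o + (p + q)  ∎
  where open ≤-Reasoning

record DegreeAtMost (G : Graph) (u : V G) (n : ℕ) : Set where
  field
    spoke  : Fin n → E G
    covers : ∀ e → Incident G u e → ∃ λ k → spoke k ≡ e

record DegreeAtLeast (G : Graph) (u : V G) (n : ℕ) : Set where
  field
    spoke     : Fin n → E G
    injective : Injective _≡_ _≡_ spoke
    incident  : ∀ k → Incident G u (spoke k)

module _ {G : Graph} {T : ℕ} (α : IntervalColoring G T) where
  open IntervalColoring α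

  -- Properness alone: the edges at a vertex of degree n ≥ 1 use n distinct
  -- colours, so two of them are at least n − 1 apart.
  span-at-least : ∀ {u n} → DegreeAtLeast G u n → 0 < n
                → ∃₂ λ e e′ → Incident G u e × Incident G u e′ × colour e + n ≤ suc (colour e′)
  span-at-least {u} deg 0<n =
    let i , j , span = injective-span (colour ∘ spoke) colour-injective 0<n
    in spoke i , spoke j , incident i , incident j , span
    where
    open DegreeAtLeast deg
    colour-injective : Injective _≡_ _≡_ (colour ∘ spoke)
    colour-injective {k} {k′} same with k ≟ᶠ k′
    ... | yes k≡k′ = k≡k′
    ... | no  k≢k′ = ⊥-elim (proper u (spoke k) (spoke k′) (incident k) (incident k′) (k≢k′ ∘ injective) same)

  -- The interval property: at a vertex of degree at most n the colours form an
  -- interval of at most n distinct values, so any two differ by less than n.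
  span-below : ∀ {u n e₁ e₂} → DegreeAtMost G u n → Incident G u e₁ → Incident G u e₂
             → colour e₂ < colour e₁ + n
  span-below {u} {n} {e₁} {e₂} deg inc₁ inc₂ with colour e₁ ≤? colour e₂
  ... | no  e₁≰e₂ = ≤-trans (≰⇒> e₁≰e₂) (m≤m+n (colour e₁) n)
  ... | yes e₁≤e₂ = begin
      suc (colour e₂)               ≡⟨ cong suc (m+[n∸m]≡n e₁≤e₂) ⟨
      suc (colour e₁ + d)           ≡⟨ +-suc (colour e₁) d ⟨
      colour e₁ + suc d             ≤⟨ +-monoʳ-≤ (colour e₁) (injective⇒≤ slot-injective) ⟩
      colour e₁ + n                 ∎
    where
    open ≤-Reasoning
    open DegreeAtMost deg
    d : ℕ
    d = colour e₂ ∸ colour e₁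
    occurs : (k : Fin (suc d)) → ∃ λ e → Incident G u e × colour e ≡ colour e₁ + toℕ k
    occurs k = intervals u e₁ e₂ _ inc₁ inc₂ (m≤m+n _ _)
      (subst (colour e₁ + toℕ k ≤_) (m+[n∸m]≡n e₁≤e₂) (+-monoʳ-≤ (colour e₁) (s≤s⁻¹ (toℕ<n k))))
    slot : Fin (suc d) → Fin n
    slot k = proj₁ (covers (proj₁ (occurs k)) (proj₁ (proj₂ (occurs k))))
    slot-spoke : ∀ k → spoke (slot k) ≡ proj₁ (occurs k)
    slot-spoke k = proj₂ (covers (proj₁ (occurs k)) (proj₁ (proj₂ (occurs k))))
    slot-injective : Injective _≡_ _≡_ slot
    slot-injective {k} {k′} eq = toℕ-injective (+-cancelˡ-≡ (colour e₁) _ _ (begin-equality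
      colour e₁ + toℕ k           ≡⟨ proj₂ (proj₂ (occurs k)) ⟨
      colour (proj₁ (occurs k))   ≡⟨ cong colour (slot-spoke k) ⟨
      colour (spoke (slot k))     ≡⟨ cong (colour ∘ spoke) eq ⟩
      colour (spoke (slot k′))    ≡⟨ cong colour (slot-spoke k′) ⟩
      colour (proj₁ (occurs k′))  ≡⟨ proj₂ (proj₂ (occurs k′)) ⟩
      colour e₁ + toℕ k′          ∎))

record Bridge (G : Graph) (e e′ : E G) (D : ℕ) : Set where
  field
    leaf hub leaf′ : V G
    f f′           : E G
    leaf-degree    : DegreeAtMost G leaf 3
    hub-degree     : DegreeAtMost G hub D
    leaf′-degree   : DegreeAtMost G leaf′ 3
    e-at-leaf      : Incident G leaf e
    f-at-leaf      : Incident G leaf f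
    f-at-hub       : Incident G hub f
    f′-at-hub      : Incident G hub f′
    f′-at-leaf′    : Incident G leaf′ f′
    e′-at-leaf′    : Incident G leaf′ e′

-- Along a bridge colours grow by at most 2 + (D − 1) + 2.
bridge-bound : ∀ {G T e e′ D} (α : IntervalColoring G T) → Bridge G e e′ D
             → IntervalColoring.colour α e′ < IntervalColoring.colour α e + (D + 4)
bridge-bound {e = e} {e′} {D} α β = subst (colour e′ <_) (cong (colour e +_) (sym (+-suc D 3))) (
  <-+-trans (suc D) 3
    (<-+-trans 2 D (span-below α leaf′-degree f′-at-leaf′ e′-at-leaf′)
                   (span-below α hub-degree f-at-hub f′-at-hub))
    (span-below α leaf-degree e-at-leaf f-at-leaf))
  where
  open IntervalColoring α
  open Bridge β

glue : ∀ {A : Set} {m n} → (Fin m → A) → (Fin n → A) → Fin (m + n) → A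
glue {m = m} f g = [ f , g ] ∘ splitAt m

glue-↑ˡ : ∀ {A : Set} {m} n (f : Fin m → A) (g : Fin n → A) i → glue f g (i ↑ˡ n) ≡ f i
glue-↑ˡ {m = m} n f g i = cong [ f , g ] (splitAt-↑ˡ m i n)

glue-↑ʳ : ∀ {A : Set} m {n} (f : Fin m → A) (g : Fin n → A) j → glue f g (m ↑ʳ j) ≡ g j
glue-↑ʳ m {n} f g j = cong [ f , g ] (splitAt-↑ʳ m n j)

glue-all : ∀ {A : Set} {m n} (P : A → Set) {f : Fin m → A} {g : Fin n → A}
         → (∀ i → P (f i)) → (∀ j → P (g j)) → ∀ k → P (glue f g k)
glue-all {m = m} P Pf Pg k with splitAt m k
... | inj₁ i = Pf i
... | inj₂ j = Pg j

glue-injective : ∀ {A : Set} {m n} {f : Fin m → A} {g : Fin n → A}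
               → Injective _≡_ _≡_ f → Injective _≡_ _≡_ g → (∀ i j → f i ≢ g j)
               → Injective _≡_ _≡_ (glue f g)
glue-injective {m = m} {n} {f} {g} f-inj g-inj disjoint {k} {k′} eq = begin
  k                       ≡⟨ join-splitAt m n k ⟨
  join m n (splitAt m k)  ≡⟨ cong (join m n) (sum-injective (splitAt m k) (splitAt m k′) eq) ⟩
  join m n (splitAt m k′) ≡⟨ join-splitAt m n k′ ⟩
  k′                      ∎
  where
  open ≡-Reasoning
  sum-injective : ∀ u w → [ f , g ] u ≡ [ f , g ] w → u ≡ w
  sum-injective (inj₁ i) (inj₁ i′) eq = cong inj₁ (f-inj eq)
  sum-injective (inj₁ i) (inj₂ j)  eq = ⊥-elim (disjoint i j eq)
  sum-injective (inj₂ j) (inj₁ i)  eq = ⊥-elim (disjoint i j (sym eq))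
  sum-injective (inj₂ j) (inj₂ j′) eq = cong inj₂ (g-inj eq)

module Structure (r s t : ℕ) where

  Vtx : Set
  Vtx = ΔV r s t

  Edge : Set
  Edge = ΔE r s t

  -- the leaves a_i, b_j, c_k; every edge joins v, x, y or z (its first
  -- endpoint) to a leaf (its second endpoint)
  data LeafView : Vtx → Set where
    isA : ∀ i → LeafView (a i)
    isB : ∀ j → LeafView (b j)
    isC : ∀ k → LeafView (c k)

  data HubView : Vtx → Set where
    isX : HubView x
    isY : HubView y
    isZ : HubView z

  leafView : ∀ e → LeafView (proj₂ (Δends e))
  leafView (va i) = isA i
  leafView (xa i) = isA i
  leafView (ya i) = isA i
  leafView (vb j) = isB j
  leafView (xb j) = isB j
  leafView (zb j) = isB j
  leafView (vc k) = isC k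
  leafView (yc k) = isC k
  leafView (zc k) = isC k

  firstEnd-not-leaf : ∀ e → ¬ LeafView (proj₁ (Δends e))
  firstEnd-not-leaf (va i) ()
  firstEnd-not-leaf (xa i) ()
  firstEnd-not-leaf (ya i) ()
  firstEnd-not-leaf (vb j) ()
  firstEnd-not-leaf (xb j) ()
  firstEnd-not-leaf (zb j) ()
  firstEnd-not-leaf (vc k) ()
  firstEnd-not-leaf (yc k) ()
  firstEnd-not-leaf (zc k) ()

  leaf-not-hub : ∀ {w} → LeafView w → ¬ HubView w
  leaf-not-hub (isA i) ()
  leaf-not-hub (isB j) ()
  leaf-not-hub (isC k) ()

  at-leaf : ∀ {ℓ e} → LeafView ℓ → Incident (Δ r s t) ℓ e → proj₂ (Δends e) ≡ ℓ
  at-leaf {e = e} ℓ-leaf (inj₁ p) = ⊥-elim (firstEnd-not-leaf e (subst LeafView (sym p) ℓ-leaf))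
  at-leaf         ℓ-leaf (inj₂ p) = p

  at-hub : ∀ {w e} → HubView w → Incident (Δ r s t) w e → proj₁ (Δends e) ≡ w
  at-hub         w-hub (inj₁ p) = p
  at-hub {e = e} w-hub (inj₂ p) = ⊥-elim (leaf-not-hub (subst LeafView p (leafView e)) w-hub)

  leafSpoke : ∀ {ℓ} → LeafView ℓ → Fin 3 → Edge
  leafSpoke (isA i) = lookup (va i ∷ xa i ∷ ya i ∷ [])
  leafSpoke (isB j) = lookup (vb j ∷ xb j ∷ zb j ∷ [])
  leafSpoke (isC k) = lookup (vc k ∷ yc k ∷ zc k ∷ [])

  leafCover : ∀ {ℓ} (ℓ-leaf : LeafView ℓ) e → proj₂ (Δends e) ≡ ℓ → ∃ λ k → leafSpoke ℓ-leaf k ≡ e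
  leafCover (isA _) (va _) refl = fzero , refl
  leafCover (isA _) (xa _) refl = fsuc fzero , refl
  leafCover (isA _) (ya _) refl = fsuc (fsuc fzero) , refl
  leafCover (isB _) (vb _) refl = fzero , refl
  leafCover (isB _) (xb _) refl = fsuc fzero , refl
  leafCover (isB _) (zb _) refl = fsuc (fsuc fzero) , refl
  leafCover (isC _) (vc _) refl = fzero , refl
  leafCover (isC _) (yc _) refl = fsuc fzero , refl
  leafCover (isC _) (zc _) refl = fsuc (fsuc fzero) , refl

  leafDegree : ∀ {ℓ} → LeafView ℓ → DegreeAtMost (Δ r s t) ℓ 3
  leafDegree ℓ-leaf = record
    { spoke = leafSpoke ℓ-leaf
    ; covers = λ e inc → leafCover ℓ-leaf e (at-leaf {e = e} ℓ-leaf inc) }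

  hubDegree : ∀ {w} → HubView w → ℕ
  hubDegree isX = r + s
  hubDegree isY = r + t
  hubDegree isZ = s + t

  hubSpoke : ∀ {w} (w-hub : HubView w) → Fin (hubDegree w-hub) → Edge
  hubSpoke isX = glue xa xb
  hubSpoke isY = glue ya yc
  hubSpoke isZ = glue zb zc

  hubCover : ∀ {w} (w-hub : HubView w) e → proj₁ (Δends e) ≡ w → ∃ λ k → hubSpoke w-hub k ≡ e
  hubCover isX (xa i) refl = i ↑ˡ s , glue-↑ˡ s xa xb i
  hubCover isX (xb j) refl = r ↑ʳ j , glue-↑ʳ r xa xb j
  hubCover isY (ya i) refl = i ↑ˡ t , glue-↑ˡ t ya yc i
  hubCover isY (yc k) refl = r ↑ʳ k , glue-↑ʳ r ya yc k
  hubCover isZ (zb j) refl = j ↑ˡ t , glue-↑ˡ t zb zc j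
  hubCover isZ (zc k) refl = s ↑ʳ k , glue-↑ʳ s zb zc k

  hubDegreeAtMost : ∀ {w} (w-hub : HubView w) → DegreeAtMost (Δ r s t) w (hubDegree w-hub)
  hubDegreeAtMost w-hub = record
    { spoke = hubSpoke w-hub
    ; covers = λ e inc → hubCover w-hub e (at-hub {e = e} w-hub inc) }

  -- Each hub misses the leaves of one class, so its degree is r + s + t minus
  -- one of r, s, t.
  hubDegree-small : 5 ≤ r → 5 ≤ s → 5 ≤ t → ∀ {w} (w-hub : HubView w) → hubDegree w-hub + 5 ≤ r + s + t
  hubDegree-small _   _   5≤t isX = +-monoʳ-≤ (r + s) 5≤t
  hubDegree-small _   5≤s _   isY = subst (r + t + 5 ≤_) (rearrange r s t) (+-monoʳ-≤ (r + t) 5≤s)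
    where
    rearrange : ∀ p q o → p + o + q ≡ p + q + o
    rearrange = solve-∀
  hubDegree-small 5≤r _   _   isZ = subst (s + t + 5 ≤_) (rearrange r s t) (+-monoʳ-≤ (s + t) 5≤r)
    where
    rearrange : ∀ p q o → q + o + p ≡ p + q + o
    rearrange = solve-∀

  vDegree : DegreeAtLeast (Δ r s t) v (r + s + t)
  vDegree = record
    { spoke = glue vab vc
    ; injective = glue-injective {f = vab} {vc} (glue-injective {f = va} {vb} va-inj vb-inj (λ _ _ ())) vc-inj
                    (glue-all (λ e → ∀ k → e ≢ vc k) {va} {vb} (λ _ _ ()) (λ _ _ ()))
    ; incident = glue-all (Incident (Δ r s t) v) {vab} {vc}
                   (glue-all (Incident (Δ r s t) v) {va} {vb} (λ _ → inj₁ refl) (λ _ → inj₁ refl))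
                   (λ _ → inj₁ refl) }
    where
    va-inj : Injective _≡_ _≡_ (va {r} {s} {t})
    va-inj refl = refl
    vb-inj : Injective _≡_ _≡_ (vb {r} {s} {t})
    vb-inj refl = refl
    vc-inj : Injective _≡_ _≡_ (vc {r} {s} {t})
    vc-inj refl = refl
    vab : Fin (r + s) → Edge
    vab = glue va vb

  -- Each leaf is adjacent to two of the three hubs, so two leaves share one.
  record CommonHub (ℓ ℓ′ : Vtx) : Set where
    constructor via
    field
      {hub}   : Vtx
      hubView : HubView hub
      f f′    : Edge
      f-ends  : Δends f ≡ (hub , ℓ)
      f′-ends : Δends f′ ≡ (hub , ℓ′)

  commonHub : ∀ {ℓ ℓ′} → LeafView ℓ → LeafView ℓ′ → CommonHub ℓ ℓ′
  commonHub (isA i) (isA i′) = via isX (xa i) (xa i′) refl refl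
  commonHub (isA i) (isB j)  = via isX (xa i) (xb j)  refl refl
  commonHub (isA i) (isC k)  = via isY (ya i) (yc k)  refl refl
  commonHub (isB j) (isA i)  = via isX (xb j) (xa i)  refl refl
  commonHub (isB j) (isB j′) = via isX (xb j) (xb j′) refl refl
  commonHub (isB j) (isC k)  = via isZ (zb j) (zc k)  refl refl
  commonHub (isC k) (isA i)  = via isY (yc k) (ya i)  refl refl
  commonHub (isC k) (isB j)  = via isZ (zc k) (zb j)  refl refl
  commonHub (isC k) (isC k′) = via isY (yc k) (yc k′) refl refl

  bridge : ∀ e e′ (h : CommonHub (proj₂ (Δends e)) (proj₂ (Δends e′)))
         → Bridge (Δ r s t) e e′ (hubDegree (CommonHub.hubView h))
  bridge e e′ (via w-hub f f′ f-ends f′-ends) = record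
    { leaf = proj₂ (Δends e) ; hub = _ ; leaf′ = proj₂ (Δends e′)
    ; f = f ; f′ = f′
    ; leaf-degree = leafDegree (leafView e)
    ; hub-degree = hubDegreeAtMost w-hub
    ; leaf′-degree = leafDegree (leafView e′)
    ; e-at-leaf = inj₂ refl
    ; f-at-leaf = inj₂ (cong proj₂ f-ends)
    ; f-at-hub = inj₁ (cong proj₁ f-ends)
    ; f′-at-hub = inj₁ (cong proj₁ f′-ends)
    ; f′-at-leaf′ = inj₂ (cong proj₂ f′-ends)
    ; e′-at-leaf′ = inj₂ refl }

theorem6 : (r s t : ℕ) → 1 ≤ r → r ≤ s → s ≤ t → 5 ≤ r → ¬ Interval𝔑 (Δ r s t)
theorem6 r s t 1≤r r≤s s≤t 5≤r (T , _ , α)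
  with span-at-least α (Structure.vDegree r s t) (≤-trans 1≤r (≤-trans (m≤m+n r s) (m≤m+n (r + s) t)))
... | e , e′ , _ , _ , wide = 1+n≰n (+-cancelˡ-≤ D 5 4 (≤-trans small narrow))
  where
  open Structure r s t
  open IntervalColoring α
  5≤s : 5 ≤ s
  5≤s = ≤-trans 5≤r r≤s
  hub : CommonHub (proj₂ (Δends e)) (proj₂ (Δends e′))
  hub = commonHub (leafView e) (leafView e′)
  D : ℕ
  D = hubDegree (CommonHub.hubView hub)
  small : D + 5 ≤ r + s + t
  small = hubDegree-small 5≤r 5≤s (≤-trans 5≤s s≤t) (CommonHub.hubView hub)
  narrow : r + s + t ≤ D + 4
  narrow = +-cancelˡ-≤ (colour e) _ _ (≤-trans wide (bridge-bound α (bridge e e′ hub)))
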